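{- Let $\Delta$ be a pure, strongly connected, $d$-dimensional simplicial complex on vertex set $[n]=\{1,\dots,n\}$ (with $d<n$ positive integers), and assume that the natural order $1<2<\dots<n$ is a unit interval order for $\Delta$. Then ordering the facets of $\Delta$ lexicographically gives a shelling of $\Delta$; that is, the vertex order induces a lex shelling of $\Delta$.
   Context: A simplicial complex is a family of finite sets closed under taking subsets; its elements are faces, a face $E$ has dimension $|E|-1$, facets are the maximal faces, and $\Delta$ is pure if all facets have the same dimension $d$. For a set of facets $F_1,\dots,F_k$, $\langle F_1,\dots,F_k\rangle$ denotes the complex consisting of all subsets of the $F_i$. The dual graph of a pure complex has a node for each facet, two facets adjacent iff they share a face of codimension one (i.e. of size $d$); $\Delta$ is strongly connected if its dual graph is connected. The order on $[n]$ is a unit interval order for $\Delta$ if for every facet $\{v_0<v_1<\dots<v_d\}$ of $\Delta$, every $(d+1)$-element subset of $\{v_0,v_0+1,\dots,v_d\}$ is a face (hence facet) of $\Delta$. A shelling of a pure $d$-dimensional complex is an ordering $F_1,\dots,F_m$ of its facets such that for every $k\in[m-1]$, the complex $\langle F_{k+1}\rangle\cap\langle F_1,\dots,F_k\rangle$ is pure of dimension $d-1$. The lexicographic order on facets compares facets written as increasing sequences $v_0<v_1<\dots<v_d$ lexicographically; a lex shelling is a shelling in which the facets appear in this lexicographic order. -}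

module Defs where

open import Level using (0ℓ)
open import Data.Nat using (ℕ; suc; _<_; _∸_)
open import Data.Fin using (Fin) renaming (_≤_ to _≤ᶠ_; _<_ to _<ᶠ_)
open import Data.Fin.Subset using (Subset; _∈_; _⊆_; _∩_; ∣_∣)
open import Data.Fin.Subset.Properties using (_∈?_)
open import Data.List using (List; filter; allFin)
open import Data.List.Relation.Binary.Lex.Strict using (Lex-<)
open import Data.Product using (Σ; ∃; ∃-syntax; _×_)
open import Relation.Binary.PropositionalEquality using (_≡_)
open import Relation.Binary.Construct.Closure.ReflexiveTransitive using (Star)

-- A (finite) set system on vertex set Fin n (the vertices 0 < 1 < ... < n-1,
-- standing for 1 < 2 < ... < n), given by its membership predicate.
Complex : ℕ → Set₁
Complex n = Subset n → Set

IsSimplicialComplex : ∀ {n} → Complex n → Set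
IsSimplicialComplex {n} Δ = ∀ (E F : Subset n) → Δ F → E ⊆ F → Δ E

IsFacet : ∀ {n} → Complex n → Subset n → Set
IsFacet {n} Δ F = Δ F × (∀ (G : Subset n) → Δ G → F ⊆ G → G ≡ F)

IsPureOfDim : ∀ {n} → ℕ → Complex n → Set
IsPureOfDim {n} k Δ =
  (∃[ F ] (IsFacet Δ F × ∣ F ∣ ≡ suc k)) ×
  (∀ (F : Subset n) → IsFacet Δ F → ∣ F ∣ ≡ suc k)

DualAdj : ∀ {n} → ℕ → Complex n → Subset n → Subset n → Set
DualAdj d Δ F G = IsFacet Δ F × IsFacet Δ G × ∣ F ∩ G ∣ ≡ d

IsStronglyConnected : ∀ {n} → ℕ → Complex n → Set
IsStronglyConnected {n} d Δ =
  ∀ (F G : Subset n) → IsFacet Δ F → IsFacet Δ G → Star (DualAdj d Δ) F G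

InInterval : ∀ {n} → Subset n → Fin n → Set
InInterval F i = (∃[ a ] (a ∈ F × a ≤ᶠ i)) × (∃[ b ] (b ∈ F × i ≤ᶠ b))

IsUnitIntervalOrder : ∀ {n} → ℕ → Complex n → Set
IsUnitIntervalOrder {n} d Δ =
  ∀ (F S : Subset n) → IsFacet Δ F →
    (∀ i → i ∈ S → InInterval F i) → ∣ S ∣ ≡ suc d → Δ S

elems : ∀ {n} → Subset n → List (Fin n)
elems {n} F = filter (_∈? F) (allFin n)

_<lex_ : ∀ {n} → Subset n → Subset n → Set
F <lex G = Lex-< _≡_ _<ᶠ_ (elems F) (elems G)

EarlierPart : ∀ {n} → Complex n → (Subset n → Subset n → Set) →
              Subset n → Complex n
EarlierPart Δ _≺_ G E = E ⊆ G × ∃[ F ] (IsFacet Δ F × F ≺ G × E ⊆ F)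

-- the ordering of the facets of a pure d-dimensional Δ given by ≺ is a
-- shelling: for every facet G other than the first one (i.e. having some
-- preceding facet), ⟨G⟩ ∩ ⟨earlier facets⟩ is pure of dimension d-1
-- (dimension d ∸ 1; d ≥ 1 in the theorem).
IsShellingOrder : ∀ {n} → ℕ → Complex n → (Subset n → Subset n → Set) → Set
IsShellingOrder {n} d Δ _≺_ =
  ∀ (G : Subset n) → IsFacet Δ G →
    (∃[ F ] (IsFacet Δ F × F ≺ G)) →
    IsPureOfDim (d ∸ 1) (EarlierPart Δ _≺_ G)

-- It suffices that every facet F preceding a facet G misses a vertex g of G whose ridge G - g lies
-- in a facet preceding G. Let m be the first vertex where F and G differ (so m ∈ F ∖ G) and g the
-- last vertex of G ∖ F; then m < g. Replacing g in G by a vertex x < g outside G gives an earlier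
-- (d+1)-set S, and S is a facet as soon as it lies in the interval [min K, max K] of some facet K.
-- If G has a gap between its minimum and g, take x there and K = G. Otherwise m lies below min G;
-- if some vertex of G exceeds g it belongs to F, and K = F, x = m work. Otherwise g = max G, and a
-- dual-graph path from F to G contains adjacent facets K, K′ with K reaching below min G and K′ not;
-- counting the ridge K ∩ K′ shows that K reaches up to every vertex of G - g, so K works with x its
-- vertex below min G.

module Submission where

open import Defs
open import Data.Nat using (ℕ; zero; suc; z≤n; s≤s; z<s; _<_)
import Data.Nat.Properties as ℕ
open import Data.Fin using (Fin; zero; suc) renaming (_≤_ to _≤ᶠ_; _<_ to _<ᶠ_)
import Data.Fin.Properties as Fin
open import Data.Fin.Subset using (Subset; inside; outside; _∈_; _∉_; _⊆_; _⊂_; _⊃_; _∩_; _∪_; _-_; ⁅_⁆; ∣_∣)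
open import Data.Fin.Subset.Properties
open import Data.Fin.Subset.Induction using (⊃-wellFounded)
open import Data.List using (List; []; _∷_; map; length; filter; allFin; tabulate)
import Data.List.Properties as List
open import Data.List.Relation.Binary.Lex.Core using (base; halt; this; next)
open import Data.List.Relation.Binary.Lex.Strict using (Lex-<; <-irreflexive)
open import Data.List.Relation.Binary.Pointwise using (≡⇒Pointwise-≡)
open import Data.Vec using ([]; _∷_; here; there)
open import Data.Product using (∃; ∃₂; ∃-syntax; _×_; _,_; proj₁; proj₂)
open import Data.Sum using (_⊎_; inj₁; inj₂)
open import Data.Empty using (⊥-elim)
open import Function using (_∘_; id)
open import Induction.WellFounded using (Acc; acc)
open import Level using (Level)
open import Relation.Binary using (Rel; tri<; tri≈; tri>)
open import Relation.Binary.Construct.Closure.ReflexiveTransitive using (Star; ε; _◅_)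
open import Relation.Binary.PropositionalEquality
open import Relation.Nullary using (¬_; Dec; yes; no)
open import Relation.Nullary.Decidable using (_×-dec_; ¬?; decidable-stable)
open import Relation.Unary using (Pred; Decidable)

private
  variable
    a ℓ ℓ′ : Level
    n : ℕ
    p q : Subset n
    x y : Fin n

module _ {A : Set a} {R : Rel A ℓ} {P : Pred A ℓ′} (P? : Decidable P) where

  crossing-edge : ∀ {x y} → Star R x y → P x → ¬ P y → ∃₂ λ u v → R u v × P u × ¬ P v
  crossing-edge ε px ¬py = ⊥-elim (¬py px)
  crossing-edge (_◅_ {j = z} r rs) px ¬py with P? z
  ... | yes pz = crossing-edge rs pz ¬py
  ... | no ¬pz = _ , _ , r , px , ¬pz

max-witness : ∀ {P : Pred (Fin n) ℓ} → Decidable P → ∃ P → ∃[ x ] P x × (∀ {y} → P y → y ≤ᶠ x)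
max-witness {suc n} P? (w , pw) with Fin.any? (λ x → P? (suc x))
... | yes ∃P∘suc with max-witness (λ x → P? (suc x)) ∃P∘suc
...   | x , px , x-max = suc x , px , λ { {zero} _ → z≤n ; {suc y} py → s≤s (x-max py) }
max-witness {suc n} P? (zero , pw) | no ∄P∘suc =
  zero , pw , λ { {zero} _ → z≤n ; {suc y} py → ⊥-elim (∄P∘suc (y , py)) }
max-witness {suc n} P? (suc w , pw) | no ∄P∘suc = ⊥-elim (∄P∘suc (w , pw))

⊈-witness : ¬ p ⊆ q → ∃[ x ] x ∈ p × x ∉ q
⊈-witness {p = p} {q} p⊈q with Fin.any? (λ x → x ∈? p ×-dec ¬? (x ∈? q))
... | yes witness = witness
... | no ∄witness = ⊥-elim (p⊈q p⊆q)
  where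
  p⊆q : p ⊆ q
  p⊆q {x} x∈p with x ∈? q
  ... | yes x∈q = x∈q
  ... | no x∉q = ⊥-elim (∄witness (x , x∈p , x∉q))

⊆⇒≡⊎⊂ : p ⊆ q → p ≡ q ⊎ p ⊂ q
⊆⇒≡⊎⊂ {p = p} {q} p⊆q with q ⊆? p
... | yes q⊆p = inj₁ (⊆-antisym p⊆q q⊆p)
... | no q⊈p = inj₂ (p⊆q , ⊈-witness q⊈p)

p⊆q∧x∉p⇒p⊆q-x : p ⊆ q → x ∉ p → p ⊆ q - x
p⊆q∧x∉p⇒p⊆q-x p⊆q x∉p y∈p = x∈p∧x≢y⇒x∈p-y (p⊆q y∈p) λ { refl → x∉p y∈p }

q-x⊆p∧x∈p⇒q⊆p : q - x ⊆ p → x ∈ p → q ⊆ p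
q-x⊆p∧x∈p⇒q⊆p {x = x} q-x⊆p x∈p {y} y∈q with y Fin.≟ x
... | yes refl = x∈p
... | no y≢x = q-x⊆p (x∈p∧x≢y⇒x∈p-y y∈q y≢x)

x∈p-y⇒x≢y : x ∈ p - y → x ≢ y
x∈p-y⇒x≢y {x = zero} {p = _ ∷ _} () refl
x∈p-y⇒x≢y {x = suc x} {p = _ ∷ _} (there x∈p-x) refl = x∈p-y⇒x≢y x∈p-x refl

x∈p⇒suc∣p-x∣≡∣p∣ : x ∈ p → suc ∣ p - x ∣ ≡ ∣ p ∣
x∈p⇒suc∣p-x∣≡∣p∣ {p = inside ∷ p} here = cong (suc ∘ ∣_∣) (p─⊥≡p p)
x∈p⇒suc∣p-x∣≡∣p∣ {p = inside ∷ p} (there x∈p) = cong suc (x∈p⇒suc∣p-x∣≡∣p∣ x∈p)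
x∈p⇒suc∣p-x∣≡∣p∣ {p = outside ∷ p} (there x∈p) = x∈p⇒suc∣p-x∣≡∣p∣ x∈p

x∉p⇒∣p∪⁅x⁆∣≡suc∣p∣ : x ∉ p → ∣ p ∪ ⁅ x ⁆ ∣ ≡ suc ∣ p ∣
x∉p⇒∣p∪⁅x⁆∣≡suc∣p∣ {x = zero} {p = inside ∷ p} x∉p = ⊥-elim (x∉p here)
x∉p⇒∣p∪⁅x⁆∣≡suc∣p∣ {x = zero} {p = outside ∷ p} _ = cong (suc ∘ ∣_∣) (∪-identityʳ p)
x∉p⇒∣p∪⁅x⁆∣≡suc∣p∣ {x = suc x} {p = inside ∷ p} x∉p = cong suc (x∉p⇒∣p∪⁅x⁆∣≡suc∣p∣ (x∉p ∘ there))
x∉p⇒∣p∪⁅x⁆∣≡suc∣p∣ {x = suc x} {p = outside ∷ p} x∉p = x∉p⇒∣p∪⁅x⁆∣≡suc∣p∣ (x∉p ∘ there)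

infix 4 _<ˡ_
_<ˡ_ : List (Fin n) → List (Fin n) → Set
_<ˡ_ = Lex-< _≡_ _<ᶠ_

map-suc⁺ : ∀ {xs ys : List (Fin n)} → xs <ˡ ys → map suc xs <ˡ map suc ys
map-suc⁺ halt = halt
map-suc⁺ (this x<y) = this (s≤s x<y)
map-suc⁺ (next refl xs<ys) = next refl (map-suc⁺ xs<ys)

map-suc⁻ : ∀ (xs ys : List (Fin n)) → map suc xs <ˡ map suc ys → xs <ˡ ys
map-suc⁻ [] [] (base ())
map-suc⁻ [] (_ ∷ _) halt = halt
map-suc⁻ (_ ∷ _) (_ ∷ _) (this (s≤s x<y)) = this x<y
map-suc⁻ (_ ∷ xs) (_ ∷ ys) (next refl xs<ys) = next refl (map-suc⁻ xs ys xs<ys)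

zero∷-<ˡ-map-suc : ∀ {xs : List (Fin (suc n))} {ys} → ys ≢ [] → zero ∷ xs <ˡ map suc ys
zero∷-<ˡ-map-suc {ys = []} ys≢[] = ⊥-elim (ys≢[] refl)
zero∷-<ˡ-map-suc {ys = _ ∷ _} _ = this z<s

elements : Subset n → List (Fin n)
elements [] = []
elements (inside ∷ p) = zero ∷ map suc (elements p)
elements (outside ∷ p) = map suc (elements p)

filter-∈?-map-suc : ∀ s (p : Subset n) xs → filter (_∈? s ∷ p) (map suc xs) ≡ map suc (filter (_∈? p) xs)
filter-∈?-map-suc s p [] = refl
filter-∈?-map-suc s p (x ∷ xs) with x ∈? p
... | yes _ = cong (suc x ∷_) (filter-∈?-map-suc s p xs)
... | no _ = filter-∈?-map-suc s p xs

elems-∷ : ∀ s (p : Subset n) → filter (_∈? s ∷ p) (tabulate suc) ≡ map suc (elems p)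
elems-∷ s p = begin
  filter (_∈? s ∷ p) (tabulate suc)         ≡⟨ cong (filter (_∈? s ∷ p)) (List.map-tabulate id suc) ⟨
  filter (_∈? s ∷ p) (map suc (allFin _))   ≡⟨ filter-∈?-map-suc s p (allFin _) ⟩
  map suc (elems p)                         ∎
  where open ≡-Reasoning

elems≡elements : (p : Subset n) → elems p ≡ elements p
elems≡elements [] = refl
elems≡elements (inside ∷ p) = cong (zero ∷_) (trans (elems-∷ inside p) (cong (map suc) (elems≡elements p)))
elems≡elements (outside ∷ p) = trans (elems-∷ outside p) (cong (map suc) (elems≡elements p))

length-elements : (p : Subset n) → length (elements p) ≡ ∣ p ∣
length-elements [] = refl
length-elements (inside ∷ p) = cong suc (trans (List.length-map suc (elements p)) (length-elements p))
length-elements (outside ∷ p) = trans (List.length-map suc (elements p)) (length-elements p)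

elements-≢[] : 0 < ∣ p ∣ → elements p ≢ []
elements-≢[] {p = p} 0<∣p∣ eq = ℕ.<⇒≢ 0<∣p∣ (trans (cong length (sym eq)) (length-elements p))

infix 4 _⊆[<_]_
_⊆[<_]_ : Subset n → Fin n → Subset n → Set
p ⊆[< x ] q = ∀ {y} → y <ᶠ x → y ∈ p → y ∈ q

⊆[<]-tail : ∀ {s t} → (s ∷ p) ⊆[< suc x ] (t ∷ q) → p ⊆[< x ] q
⊆[<]-tail p⊆q y<x y∈p = drop-there (p⊆q (s≤s y<x) (there y∈p))

x∈p⇒0<∣p∣ : x ∈ p → 0 < ∣ p ∣
x∈p⇒0<∣p∣ x∈p = ℕ.≤-<-trans z≤n (x∈p⇒∣p-x∣<∣p∣ x∈p)

<ˡ-intro : x ∈ p → x ∉ q → y ∈ q → x <ᶠ y → p ⊆[< x ] q → q ⊆[< x ] p → elements p <ˡ elements q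
<ˡ-intro {x = zero} {p = inside ∷ _} {q = inside ∷ _} _ x∉q = ⊥-elim (x∉q here)
<ˡ-intro {x = zero} {p = inside ∷ _} {q = outside ∷ q} _ _ (there y∈q) _ _ _ =
  zero∷-<ˡ-map-suc (elements-≢[] {p = q} (x∈p⇒0<∣p∣ y∈q))
<ˡ-intro {x = suc _} {p = inside ∷ _} {q = inside ∷ _} (there x∈p) x∉q (there y∈q) (s≤s x<y) p⊆q q⊆p =
  next refl (map-suc⁺ (<ˡ-intro x∈p (x∉q ∘ there) y∈q x<y (⊆[<]-tail p⊆q) (⊆[<]-tail q⊆p)))
<ˡ-intro {x = suc _} {p = outside ∷ _} {q = outside ∷ _} (there x∈p) x∉q (there y∈q) (s≤s x<y) p⊆q q⊆p =
  map-suc⁺ (<ˡ-intro x∈p (x∉q ∘ there) y∈q x<y (⊆[<]-tail p⊆q) (⊆[<]-tail q⊆p))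
<ˡ-intro {x = suc _} {p = inside ∷ _} {q = outside ∷ _} _ _ _ _ p⊆q _ with () ← p⊆q z<s here
<ˡ-intro {x = suc _} {p = outside ∷ _} {q = inside ∷ _} _ _ _ _ _ q⊆p with () ← q⊆p z<s here

first-difference-∷ : ∀ s → ∃[ x ] x ∈ p × x ∉ q × q ⊆[< x ] p →
                     ∃[ x ] x ∈ s ∷ p × x ∉ s ∷ q × (s ∷ q) ⊆[< x ] (s ∷ p)
first-difference-∷ {p = p} {q = q} s (x , x∈p , x∉q , q⊆p) = suc x , there x∈p , x∉q ∘ drop-there , q⊆p′
  where
  q⊆p′ : (s ∷ q) ⊆[< suc x ] (s ∷ p)
  q⊆p′ {zero} _ here = here
  q⊆p′ {suc y} (s≤s y<x) (there y∈q) = there (q⊆p y<x y∈q)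

<ˡ-elim : ∣ p ∣ ≡ ∣ q ∣ → elements p <ˡ elements q → ∃[ x ] x ∈ p × x ∉ q × q ⊆[< x ] p
<ˡ-elim {p = []} {q = []} _ (base ())
<ˡ-elim {p = inside ∷ p} {q = inside ∷ q} ∣p∣≡∣q∣ (next refl p<q) =
  first-difference-∷ inside (<ˡ-elim (ℕ.suc-injective ∣p∣≡∣q∣) (map-suc⁻ (elements p) (elements q) p<q))
<ˡ-elim {p = outside ∷ p} {q = outside ∷ q} ∣p∣≡∣q∣ p<q =
  first-difference-∷ outside (<ˡ-elim ∣p∣≡∣q∣ (map-suc⁻ (elements p) (elements q) p<q))
<ˡ-elim {p = inside ∷ _} {q = outside ∷ _} _ _ = zero , here , (λ ()) , λ ()
<ˡ-elim {p = outside ∷ p} {q = inside ∷ _} ∣p∣≡∣q∣ p<q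
  with elements p | elements-≢[] {p = p} (subst (0 <_) (sym ∣p∣≡∣q∣) z<s)
... | [] | ≢[] = ⊥-elim (≢[] refl)
... | _ ∷ _ | _ with p<q
...   | this ()
...   | next () _

<lex-intro : x ∈ p → x ∉ q → y ∈ q → x <ᶠ y → p ⊆[< x ] q → q ⊆[< x ] p → p <lex q
<lex-intro {p = p} {q = q} x∈p x∉q y∈q x<y p⊆q q⊆p =
  subst₂ _<ˡ_ (sym (elems≡elements p)) (sym (elems≡elements q)) (<ˡ-intro x∈p x∉q y∈q x<y p⊆q q⊆p)

<lex-elim : ∣ p ∣ ≡ ∣ q ∣ → p <lex q → ∃[ x ] x ∈ p × x ∉ q × q ⊆[< x ] p
<lex-elim {p = p} {q = q} ∣p∣≡∣q∣ p<q =
  <ˡ-elim ∣p∣≡∣q∣ (subst₂ _<ˡ_ (elems≡elements p) (elems≡elements q) p<q)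

<lex-irrefl : ¬ p <lex p
<lex-irrefl = <-irreflexive Fin.<-irrefl (≡⇒Pointwise-≡ refl)

FacetsOfSize : ℕ → Complex n → Set
FacetsOfSize {n} k Δ = ∀ (F : Subset n) → IsFacet Δ F → ∣ F ∣ ≡ k

module _ {Δ : Complex n} where

  -- Δ is not assumed decidable, so only the double negation is available; it suffices to refute
  -- faces larger than every facet.
  face⊆facet : ∀ {T} → Δ T → ¬ ¬ (∃[ H ] IsFacet Δ H × T ⊆ H)
  face⊆facet {T} = go (⊃-wellFounded T)
    where
    go : ∀ {T} → Acc _⊃_ T → Δ T → ¬ ¬ (∃[ H ] IsFacet Δ H × T ⊆ H)
    go {T} (acc rs) ΔT ∄H = ∄H (T , (ΔT , maximal) , id)
      where
      maximal : ∀ G → Δ G → T ⊆ G → G ≡ T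
      maximal G ΔG T⊆G with ⊆⇒≡⊎⊂ T⊆G
      ... | inj₁ T≡G = sym T≡G
      ... | inj₂ T⊂G = ⊥-elim (go (rs T⊂G) ΔG λ (H , H-facet , G⊆H) → ∄H (H , H-facet , G⊆H ∘ T⊆G))

  ∣G-x∣≡k : ∀ {k G} → FacetsOfSize (suc k) Δ → IsFacet Δ G → x ∈ G → ∣ G - x ∣ ≡ k
  ∣G-x∣≡k {G = G} facet-size G-facet x∈G =
    ℕ.suc-injective (trans (x∈p⇒suc∣p-x∣≡∣p∣ x∈G) (facet-size G G-facet))

  face-of-facet-size⇒facet : ∀ {k S} → FacetsOfSize k Δ → Δ S → ∣ S ∣ ≡ k → IsFacet Δ S
  face-of-facet-size⇒facet {k} {S} facet-size ΔS ∣S∣≡k = ΔS , maximal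
    where
    maximal : ∀ G → Δ G → S ⊆ G → G ≡ S
    maximal G ΔG S⊆G with ⊆⇒≡⊎⊂ S⊆G
    ... | inj₁ S≡G = sym S≡G
    ... | inj₂ S⊂G = ⊥-elim (face⊆facet ΔG λ (H , H-facet , G⊆H) → ℕ.<-irrefl refl (begin-strict
      k       ≡⟨ ∣S∣≡k ⟨
      ∣ S ∣   <⟨ p⊂q⇒∣p∣<∣q∣ S⊂G ⟩
      ∣ G ∣   ≤⟨ p⊆q⇒∣p∣≤∣q∣ G⊆H ⟩
      ∣ H ∣   ≡⟨ facet-size H H-facet ⟩
      k       ∎))
      where open ℕ.≤-Reasoning

InEarlierFacet : Complex n → (Subset n → Subset n → Set) → Subset n → Subset n → Set
InEarlierFacet Δ _≺_ G E = ∃[ F ] IsFacet Δ F × F ≺ G × E ⊆ F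

ExchangeProperty : Complex n → (Subset n → Subset n → Set) → Set
ExchangeProperty Δ _≺_ = ∀ {F G} → IsFacet Δ F → IsFacet Δ G → F ≺ G →
  ∃[ g ] g ∈ G × g ∉ F × InEarlierFacet Δ _≺_ G (G - g)

exchange⇒shelling : ∀ {k} {Δ : Complex n} {_≺_} → (∀ {G} → ¬ G ≺ G) → FacetsOfSize (suc (suc k)) Δ →
                    ExchangeProperty Δ _≺_ → IsShellingOrder (suc k) Δ _≺_
exchange⇒shelling {k = k} {Δ} {_≺_} ≺-irrefl facet-size exchange G G-facet (F , F-facet , F≺G)
  with exchange F-facet G-facet F≺G
... | g , g∈G , _ , earlier =
  (G - g , earlier-ridge-facet g∈G earlier , ∣G-x∣≡k facet-size G-facet g∈G) , all-facets
  where
  earlier-ridge-facet : x ∈ G → InEarlierFacet Δ _≺_ G (G - x) → IsFacet (EarlierPart Δ _≺_ G) (G - x)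
  earlier-ridge-facet {x} x∈G in-earlier = (p─q⊆p G ⁅ x ⁆ , in-earlier) , maximal
    where
    maximal : ∀ E → EarlierPart Δ _≺_ G E → G - x ⊆ E → E ≡ G - x
    maximal E (E⊆G , F , F-facet , F≺G , E⊆F) G-x⊆E with x ∈? E
    ... | no x∉E = ⊆-antisym (p⊆q∧x∉p⇒p⊆q-x E⊆G x∉E) G-x⊆E
    ... | yes x∈E = ⊥-elim (≺-irrefl (subst (_≺ G) F≡G F≺G))
      where
      F≡G : F ≡ G
      F≡G = proj₂ G-facet F (proj₁ F-facet) (E⊆F ∘ q-x⊆p∧x∈p⇒q⊆p G-x⊆E x∈E)

  all-facets : ∀ E → IsFacet (EarlierPart Δ _≺_ G) E → ∣ E ∣ ≡ suc k
  all-facets E ((E⊆G , F′ , F′-facet , F′≺G , E⊆F′) , E-maximal) with exchange F′-facet G-facet F′≺G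
  ... | x , x∈G , x∉F′ , earlier′ = begin
    ∣ E ∣      ≡⟨ cong ∣_∣ (E-maximal (G - x) G-x-earlier E⊆G-x) ⟨
    ∣ G - x ∣  ≡⟨ ∣G-x∣≡k facet-size G-facet x∈G ⟩
    suc k      ∎
    where
    open ≡-Reasoning
    G-x-earlier = proj₁ (earlier-ridge-facet x∈G earlier′)
    E⊆G-x = p⊆q∧x∉p⇒p⊆q-x E⊆G (x∉F′ ∘ E⊆F′)

-- InInterval K i unfolds to AboveMin K i × BelowMax K i.
AboveMin : Subset n → Fin n → Set
AboveMin G y = ∃[ a ] a ∈ G × a ≤ᶠ y

BelowMax : Subset n → Fin n → Set
BelowMax G y = ∃[ b ] b ∈ G × y ≤ᶠ b

aboveMin? : ∀ (G : Subset n) → Decidable (AboveMin G)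
aboveMin? G y = Fin.any? λ a → a ∈? G ×-dec a Fin.≤? y

belowMax? : ∀ (G : Subset n) → Decidable (BelowMax G)
belowMax? G y = Fin.any? λ b → b ∈? G ×-dec y Fin.≤? b

¬AboveMin⇒< : ¬ AboveMin p x → y ∈ p → x <ᶠ y
¬AboveMin⇒< x-below y∈p = ℕ.≰⇒> λ y≤x → x-below (_ , y∈p , y≤x)

∈⇒InInterval : x ∈ p → InInterval p x
∈⇒InInterval x∈p = (_ , x∈p , ℕ.≤-refl) , (_ , x∈p , ℕ.≤-refl)

ReachesBelow : Subset n → Subset n → Set
ReachesBelow G K = ∃[ h ] h ∈ K × ¬ AboveMin G h

reachesBelow? : ∀ (G : Subset n) → Decidable (ReachesBelow G)
reachesBelow? G K = Fin.any? λ h → h ∈? K ×-dec ¬? (aboveMin? G h)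

¬ReachesBelow-self : ¬ ReachesBelow p p
¬ReachesBelow-self (h , h∈p , h-below) = h-below (h , h∈p , ℕ.≤-refl)

Gap : Subset n → Fin n → Set
Gap G g = ∃[ y ] y ∉ G × AboveMin G y × y <ᶠ g

gap? : ∀ (G : Subset n) g → Dec (Gap G g)
gap? G g = Fin.any? λ y → ¬? (y ∈? G) ×-dec aboveMin? G y ×-dec y Fin.<? g

module _ {d} {Δ : Complex n} (facet-size : FacetsOfSize (suc d) Δ) (unit-interval : IsUnitIntervalOrder d Δ) where

  swap-below : ∀ {G g x K} → IsFacet Δ G → g ∈ G → x ∉ G → x <ᶠ g →
               IsFacet Δ K → InInterval K x → (∀ {s} → s ∈ G - g → InInterval K s) →
               InEarlierFacet Δ _<lex_ G (G - g)
  swap-below {G} {g} {x} {K} G-facet g∈G x∉G x<g K-facet x∈[K] G-g⊆[K] =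
    S , S-facet , S<G , p⊆p∪q ⁅ x ⁆
    where
    S = (G - g) ∪ ⁅ x ⁆

    ∣S∣≡1+d : ∣ S ∣ ≡ suc d
    ∣S∣≡1+d = begin
      ∣ (G - g) ∪ ⁅ x ⁆ ∣  ≡⟨ x∉p⇒∣p∪⁅x⁆∣≡suc∣p∣ (x∉G ∘ p─q⊆p G ⁅ g ⁆) ⟩
      suc ∣ G - g ∣        ≡⟨ cong suc (∣G-x∣≡k facet-size G-facet g∈G) ⟩
      suc d                ∎
      where open ≡-Reasoning

    S⊆[K] : ∀ i → i ∈ S → InInterval K i
    S⊆[K] i i∈S with x∈p∪q⁻ (G - g) ⁅ x ⁆ i∈S
    ... | inj₁ i∈G-g = G-g⊆[K] i∈G-g
    ... | inj₂ i∈⁅x⁆ = subst (InInterval K) (sym (x∈⁅y⁆⇒x≡y x i∈⁅x⁆)) x∈[K]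

    S-facet : IsFacet Δ S
    S-facet = face-of-facet-size⇒facet facet-size (unit-interval K S K-facet S⊆[K] ∣S∣≡1+d) ∣S∣≡1+d

    S⊆G : S ⊆[< x ] G
    S⊆G y<x y∈S with x∈p∪q⁻ (G - g) ⁅ x ⁆ y∈S
    ... | inj₁ y∈G-g = p─q⊆p G ⁅ g ⁆ y∈G-g
    ... | inj₂ y∈⁅x⁆ = ⊥-elim (Fin.<⇒≢ y<x (x∈⁅y⁆⇒x≡y x y∈⁅x⁆))

    G⊆S : G ⊆[< x ] S
    G⊆S y<x y∈G = x∈p∪q⁺ (inj₁ (x∈p∧x≢y⇒x∈p-y y∈G (Fin.<⇒≢ (ℕ.<-trans y<x x<g))))

    S<G : S <lex G
    S<G = <lex-intro (x∈p∪q⁺ (inj₂ (x∈⁅x⁆ x))) x∉G g∈G x<g S⊆G G⊆S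

  module _ {F G m g} (G-facet : IsFacet Δ G) (g∈G : g ∈ G) (m∈F : m ∈ F) (m∉G : m ∉ G) (m<g : m <ᶠ g)
           (∄gap : ¬ Gap G g) where

    m-below : ¬ AboveMin G m
    m-below m-above = ∄gap (m , m∉G , m-above , m<g)

    gapless : ∀ {y} → y <ᶠ g → AboveMin G y → y ∈ G
    gapless {y} y<g y-above = decidable-stable (y ∈? G) λ y∉G → ∄gap (y , y∉G , y-above , y<g)

    exchange-via-F : IsFacet Δ F → (∀ {y} → y ∈ G → g <ᶠ y → y ∈ F) → ∀ {s} → s ∈ G → g <ᶠ s →
                           InEarlierFacet Δ _<lex_ G (G - g)
    exchange-via-F F-facet above-g {s} s∈G g<s =
      swap-below G-facet g∈G m∉G m<g F-facet (∈⇒InInterval m∈F) G-g⊆[F]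
      where
      G-g⊆[F] : ∀ {t} → t ∈ G - g → InInterval F t
      G-g⊆[F] {t} t∈G-g = (m , m∈F , ℕ.<⇒≤ (¬AboveMin⇒< m-below t∈G)) , F-reaches
        where
        t∈G = p─q⊆p G ⁅ g ⁆ t∈G-g
        F-reaches : BelowMax F t
        F-reaches with t Fin.≤? s
        ... | yes t≤s = s , above-g s∈G g<s , t≤s
        ... | no t≰s = t , above-g t∈G (ℕ.<-trans g<s (ℕ.≰⇒> t≰s)) , ℕ.≤-refl

    meet⊆G-g-s : ∀ {K K′ s} → s ∈ G - g → s <ᶠ g →
                 (∀ {y} → y ∈ K′ → AboveMin G y) → ¬ BelowMax K s → K ∩ K′ ⊆ G - g - s
    meet⊆G-g-s {K} {K′} {s} s∈G-g s<g K′-above K-below-s {y} y∈K∩K′ with x∈p∩q⁻ K K′ y∈K∩K′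
    ... | y∈K , y∈K′ = x∈p∧x≢y⇒x∈p-y (x∈p∧x≢y⇒x∈p-y y∈G (Fin.<⇒≢ y<g)) (Fin.<⇒≢ y<s)
      where
      y<s : y <ᶠ s
      y<s = ℕ.≰⇒> λ s≤y → K-below-s (y , y∈K , s≤y)
      y<g : y <ᶠ g
      y<g = ℕ.<-trans y<s s<g
      y∈G : y ∈ G
      y∈G = gapless y<g (K′-above y∈K′)

    exchange-via-path : Star (DualAdj d Δ) F G → (∀ {s} → s ∈ G → ¬ g <ᶠ s) → InEarlierFacet Δ _<lex_ G (G - g)
    exchange-via-path F⇝G g-last with crossing-edge (reachesBelow? G) F⇝G (m , m∈F , m-below) ¬ReachesBelow-self
    ... | K , K′ , (K-facet , _ , ∣K∩K′∣≡d) , (h , h∈K , h-below) , ¬K′-below =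
      swap-below G-facet g∈G h∉G (¬AboveMin⇒< h-below g∈G) K-facet (∈⇒InInterval h∈K) G-g⊆[K]
      where
      h∉G : h ∉ G
      h∉G h∈G = h-below (_ , h∈G , ℕ.≤-refl)

      K′-above : ∀ {y} → y ∈ K′ → AboveMin G y
      K′-above {y} y∈K′ = decidable-stable (aboveMin? G y) λ y-below → ¬K′-below (y , y∈K′ , y-below)

      G-g⊆[K] : ∀ {s} → s ∈ G - g → InInterval K s
      G-g⊆[K] {s} s∈G-g = (h , h∈K , ℕ.<⇒≤ (¬AboveMin⇒< h-below s∈G)) , K-reaches
        where
        s∈G = p─q⊆p G ⁅ g ⁆ s∈G-g
        s<g : s <ᶠ g
        s<g = Fin.≤∧≢⇒< (ℕ.≮⇒≥ (g-last s∈G)) (x∈p-y⇒x≢y s∈G-g)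
        -- Otherwise K lies below s, and the ridge K ∩ K′ of d vertices would fit into G - g - s.
        K-reaches : BelowMax K s
        K-reaches = decidable-stable (belowMax? K s) λ K-below-s → ℕ.<-irrefl refl (begin-strict
          d               ≡⟨ ∣K∩K′∣≡d ⟨
          ∣ K ∩ K′ ∣      ≤⟨ p⊆q⇒∣p∣≤∣q∣ (meet⊆G-g-s s∈G-g s<g K′-above K-below-s) ⟩
          ∣ G - g - s ∣   <⟨ x∈p⇒∣p-x∣<∣p∣ s∈G-g ⟩
          ∣ G - g ∣       ≡⟨ ∣G-x∣≡k facet-size G-facet g∈G ⟩
          d               ∎)
          where open ℕ.≤-Reasoning

  lex-pivots : ∀ {F G} → IsFacet Δ F → IsFacet Δ G → F <lex G →
               ∃₂ λ m g → m ∈ F × m ∉ G × g ∈ G × g ∉ F × m <ᶠ g ×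
                          (∀ {y} → y ∈ G → g <ᶠ y → y ∈ F)
  lex-pivots {F} {G} F-facet G-facet F<G
    with <lex-elim (trans (facet-size F F-facet) (sym (facet-size G G-facet))) F<G
  ... | m , m∈F , m∉G , G⊆F-below-m
    with max-witness (λ y → y ∈? G ×-dec ¬? (y ∈? F)) (⊈-witness G⊈F)
    where
    G⊈F : ¬ G ⊆ F
    G⊈F G⊆F = m∉G (subst (m ∈_) (proj₂ G-facet F (proj₁ F-facet) G⊆F) m∈F)
  ... | g , (g∈G , g∉F) , g-max = m , g , m∈F , m∉G , g∈G , g∉F , m<g , above-g
    where
    m<g : m <ᶠ g
    m<g with Fin.<-cmp m g
    ... | tri< m<g _ _ = m<g
    ... | tri≈ _ refl _ = ⊥-elim (m∉G g∈G)
    ... | tri> _ _ g<m = ⊥-elim (g∉F (G⊆F-below-m g<m g∈G))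

    above-g : ∀ {y} → y ∈ G → g <ᶠ y → y ∈ F
    above-g {y} y∈G g<y = decidable-stable (y ∈? F) λ y∉F → ℕ.<⇒≱ g<y (g-max (y∈G , y∉F))

  ridge-in-earlier-facet : ∀ {F G m g} → IsStronglyConnected d Δ → IsFacet Δ F → IsFacet Δ G →
                           m ∈ F → m ∉ G → g ∈ G → m <ᶠ g → (∀ {y} → y ∈ G → g <ᶠ y → y ∈ F) →
                           InEarlierFacet Δ _<lex_ G (G - g)
  ridge-in-earlier-facet {F} {G} {g = g} connected F-facet G-facet m∈F m∉G g∈G m<g above-g with gap? G g
  ... | yes (y , y∉G , y-above , y<g) =
    swap-below G-facet g∈G y∉G y<g G-facet (y-above , _ , g∈G , ℕ.<⇒≤ y<g)
               (∈⇒InInterval ∘ p─q⊆p G ⁅ g ⁆)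
  ... | no ∄gap with Fin.any? (λ s → s ∈? G ×-dec g Fin.<? s)
  ...   | yes (s , s∈G , g<s) =
    exchange-via-F G-facet g∈G m∈F m∉G m<g ∄gap F-facet above-g s∈G g<s
  ...   | no ∄above-g =
    exchange-via-path G-facet g∈G m∈F m∉G m<g ∄gap (connected F G F-facet G-facet)
                      λ s∈G g<s → ∄above-g (_ , s∈G , g<s)

  lex-exchange : IsStronglyConnected d Δ → ExchangeProperty Δ _<lex_
  lex-exchange connected F-facet G-facet F<G with lex-pivots F-facet G-facet F<G
  ... | m , g , m∈F , m∉G , g∈G , g∉F , m<g , above-g =
    g , g∈G , g∉F , ridge-in-earlier-facet connected F-facet G-facet m∈F m∉G g∈G m<g above-g

theorem3p4 : (n d : ℕ) → 0 < d → d < n → (Δ : Complex n) →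
    IsSimplicialComplex Δ → IsPureOfDim d Δ → IsStronglyConnected d Δ →
    IsUnitIntervalOrder d Δ → IsShellingOrder d Δ _<lex_
theorem3p4 _ (suc _) _ _ _ _ pure connected unit-interval =
  exchange⇒shelling <lex-irrefl facet-size (lex-exchange facet-size unit-interval connected)
  where
  facet-size = proj₂ pure
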